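{- The map $\phi:\mathcal L_{[0,p-1]}\to\mathcal L_{[1,p]}$ is well defined (i.e. its values lie in $\mathcal L_{[1,p]}$) and is a bijection.
   Context: Fix $f\ge1$ and a prime $p$. An interval in $\mathbb Z/f$ is a stretch $[\![i,j]\!]=\{i,i+1,\dots,j\}$ with its start point $i$ and end point $j$ remembered; its successor is $j+1$. Let $\mathcal I$ denote a collection of pairwise disjoint intervals in $\mathbb Z/f$, each labelled with a sign $+$ or $-$. $\mathcal L_{[0,p-1]}$ is the set of pairs $(\alpha,\mathcal I)$, $\alpha:\mathbb Z/f\to\{0,\dots,p-1\}$, such that: (A1) $\alpha(I)\subset\{0,1\}$ for each $I\in\mathcal I$; (A2) for $i\in\bigcup\mathcal I$, $\alpha(i)=1$ iff $i$ is the start point of an $\mathcal I$-interval and $i-1\in\bigcup\mathcal I$; (A3) if $i\notin\bigcup\mathcal I$ and $\alpha(i)=0$ then $i-1\in\bigcup\mathcal I$; (A4) the successor of a positive $\mathcal I$-interval lies in no $\mathcal I$-interval and has $\alpha$-value in $[0,p-2]$; (A5) the successor of a negative $\mathcal I$-interval lies in another $\mathcal I$-interval or has $\alpha$-value in $[2,p-1]$. $\mathcal L_{[1,p]}$ is the set of pairs $(\beta,\mathcal I)$, $\beta:\mathbb Z/f\to\{1,\dots,p\}$, such that: (B1) $\beta(I)\subset\{p-1,p\}$ for each $I\in\mathcal I$; (B2) the set of start points of $\mathcal I$-intervals equals $\beta^{ -1}(p)$; (B3) the successor of a positive $\mathcal I$-interval lies in no $\mathcal I$-interval and has $\beta$-value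 in $[1,p-1]$; (B4) the successor of a negative $\mathcal I$-interval lies in another $\mathcal I$-interval or has $\beta$-value in $[1,p-2]$. $\phi(\alpha,\mathcal I)=(\beta,\mathcal I)$ where $\beta$ is obtained from $\alpha$ as follows: on each $\mathcal I$-interval the start point gets value $p$ and every other point gets value $p-1$; if the successor of an interval with sign $\pm$ lies in no $\mathcal I$-interval, its value $a$ is changed to $a\pm1$; all other values are unchanged. (Pictorially: $\underline{(1),0,\dots,0,}_{\pm}a\mapsto\underline{p,p-1,\dots,p-1,}_{\pm}a\pm1$ and $\underline{\dots,0,0,}_-\underline{1,0,\dots}\mapsto\underline{\dots,p-1,p-1,}_-\underline{p,p-1,\dots}$.) -}

module Defs where

open import Data.Nat using (ℕ; zero; suc; _+_; _∸_; _≤_; _<_; _%_)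
open import Data.Nat.DivMod using (m%n<n)
open import Data.Fin using (Fin; toℕ; fromℕ<) renaming (_≟_ to _≟ᶠ_)
open import Data.Bool using (Bool; if_then_else_)
open import Data.Maybe using (Maybe; just; nothing)
open import Data.Product using (_×_; ∃)
open import Data.Sum using (_⊎_)
open import Data.List using (List; []; _∷_)
open import Data.List.Relation.Unary.All using (All)
open import Data.List.Relation.Unary.Any using (Any; any?)
open import Data.List.Relation.Unary.AllPairs using (AllPairs)
open import Data.List.Membership.Propositional using (_∈_)
open import Relation.Nullary using (¬_; does)
open import Relation.Binary.PropositionalEquality using (_≡_; _≢_)
open import Function.Bundles using (_⇔_)

-- Throughout, f = suc n (so f ≥ 1) and ℤ/f is represented by Fin (suc n).

_⊕_ : {n : ℕ} → Fin (suc n) → ℕ → Fin (suc n)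
_⊕_ {n} x k = fromℕ< (m%n<n (toℕ x + k) (suc n))

-- predecessor x - 1 = x + (f - 1) in ℤ/f
pred : {n : ℕ} → Fin (suc n) → Fin (suc n)
pred {n} x = x ⊕ n

data Sign : Set where
  plus minus : Sign

-- An interval [[i, i+len-1]] in ℤ/f with start point i = start, length len
-- (1 ≤ len ≤ f is imposed in WF below), end point i+len-1, and a sign.
record Interval (n : ℕ) : Set where
  constructor mkI
  field
    start : Fin (suc n)
    len   : ℕ
    sign  : Sign
open Interval public

succI : {n : ℕ} → Interval n → Fin (suc n)
succI I = start I ⊕ len I

offset : {n : ℕ} → Interval n → Fin (suc n) → ℕ
offset {n} I x = (toℕ x + (suc n ∸ toℕ (start I))) % suc n

-- x ∈ I  iff  x ∈ {start, start+1, ..., start+len-1}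
_∈ᴵ_ : {n : ℕ} → Fin (suc n) → Interval n → Set
x ∈ᴵ I = offset I x < len I

Disjoint : {n : ℕ} → Interval n → Interval n → Set
Disjoint {n} I J = (x : Fin (suc n)) → ¬ (x ∈ᴵ I × x ∈ᴵ J)

-- A collection 𝓘 of pairwise disjoint signed intervals, given as a list.
WF : {n : ℕ} → List (Interval n) → Set
WF {n} L = All (λ I → 1 ≤ len I × len I ≤ suc n) L × AllPairs Disjoint L

InU : {n : ℕ} → List (Interval n) → Fin (suc n) → Set
InU L x = Any (λ I → x ∈ᴵ I) L

IsStart : {n : ℕ} → List (Interval n) → Fin (suc n) → Set
IsStart L x = Any (λ I → start I ≡ x) L

SuccInOther : {n : ℕ} → List (Interval n) → Interval n → Set
SuccInOther L I = ∃ λ J → J ∈ L × J ≢ I × succI I ∈ᴵ J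

-- The set 𝓛_[0,p-1]
InLA : {n : ℕ} → ℕ → (Fin (suc n) → ℕ) → List (Interval n) → Set
InLA {n} p α L =
  WF L
  × (∀ x → α x ≤ p ∸ 1)
  -- (A1)
  × (∀ I → I ∈ L → ∀ x → x ∈ᴵ I → α x ≤ 1)
  -- (A2)
  × (∀ x → InU L x → (α x ≡ 1 ⇔ (IsStart L x × InU L (pred x))))
  -- (A3)
  × (∀ x → ¬ InU L x → α x ≡ 0 → InU L (pred x))
  -- (A4)
  × (∀ I → I ∈ L → sign I ≡ plus → ¬ InU L (succI I) × α (succI I) ≤ p ∸ 2)
  -- (A5)
  × (∀ I → I ∈ L → sign I ≡ minus →
       SuccInOther L I ⊎ (2 ≤ α (succI I) × α (succI I) ≤ p ∸ 1))

-- The set 𝓛_[1,p]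
InLB : {n : ℕ} → ℕ → (Fin (suc n) → ℕ) → List (Interval n) → Set
InLB {n} p β L =
  WF L
  × (∀ x → 1 ≤ β x × β x ≤ p)
  -- (B1)
  × (∀ I → I ∈ L → ∀ x → x ∈ᴵ I → β x ≡ p ∸ 1 ⊎ β x ≡ p)
  -- (B2)
  × (∀ x → IsStart L x ⇔ β x ≡ p)
  -- (B3)
  × (∀ I → I ∈ L → sign I ≡ plus →
       ¬ InU L (succI I) × (1 ≤ β (succI I) × β (succI I) ≤ p ∸ 1))
  -- (B4)
  × (∀ I → I ∈ L → sign I ≡ minus →
       SuccInOther L I ⊎ (1 ≤ β (succI I) × β (succI I) ≤ p ∸ 2))

-- sign of an interval of L whose successor is x (first one found), if any
succSign : {n : ℕ} → List (Interval n) → Fin (suc n) → Maybe Sign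
succSign [] x = nothing
succSign (I ∷ L) x = if does (succI I ≟ᶠ x) then just (sign I) else succSign L x

-- value change at a successor point lying in no interval
bump : Maybe Sign → ℕ → ℕ
bump (just plus)  a = a + 1
bump (just minus) a = a ∸ 1
bump nothing      a = a

-- the β-component of φ(α, 𝓘)
phi : {n : ℕ} → ℕ → (Fin (suc n) → ℕ) → List (Interval n) → Fin (suc n) → ℕ
phi p α L x =
  if does (any? (λ I → start I ≟ᶠ x) L) then p
  else if does (any? (λ I → Data.Nat._<?_ (offset I x) (len I)) L) then p ∸ 1
  else bump (succSign L x) (α x)

module Submission where

-- φ only changes α pointwise and never changes 𝓘, so everything reduces to
-- a classification of the points of ℤ/f relative to 𝓘: a point is a start
-- point, an interior point of ⋃𝓘, or lies outside ⋃𝓘; in the last case it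
-- may be the successor of (exactly one, by disjointness) interval, whose sign
-- is recorded by 'succSign'.  On start and interior points φ forgets α
-- (there α is forced by (A1)-(A2)), outside it applies 'bump' by ±1 or 0.

open import Defs
open import Data.Nat using (ℕ; suc)
open import Data.Nat.Primality using (Prime)
open import Data.Fin using (Fin)
open import Data.List using (List)
open import Data.Product using (_×_; ∃)
open import Relation.Binary.PropositionalEquality using (_≗_)

open import Data.Nat using (zero; _+_; _∸_; _≤_; _<_; _<?_; z≤n; s≤s; NonZero; NonTrivial)
open import Data.Nat.Properties
open import Data.Nat.DivMod using (_%_; %-distribˡ-+; m%n%n≡m%n; [m+n]%n≡m%n; m<n⇒m%n≡m; n%n≡0)
open import Data.Nat.Primality using (prime⇒nonTrivial)
open import Data.Fin using (toℕ) renaming (_≟_ to _≟ᶠ_)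
open import Data.Fin.Properties using (toℕ-injective; toℕ-fromℕ<; toℕ<n)
open import Data.Bool using (if_then_else_)
open import Data.Maybe using (Maybe; just; nothing)
open import Data.Maybe.Properties using (just-injective)
open import Data.Product using (_,_; proj₁; proj₂)
open import Data.Sum using (_⊎_; inj₁; inj₂)
open import Data.List using (_∷_)
open import Data.List.Relation.Unary.All using (_∷_) renaming (lookup to All-lookup)
open import Data.List.Relation.Unary.Any using (here; there; any?)
open import Data.List.Relation.Unary.AllPairs using (AllPairs; _∷_)
open import Data.List.Membership.Propositional using (_∈_; find; lose)
open import Relation.Nullary using (Dec; yes; no; does; ¬_)
open import Relation.Nullary.Decidable using (dec-true; dec-false)
open import Relation.Binary.PropositionalEquality
  using (_≡_; _≢_; refl; sym; trans; cong; subst; module ≡-Reasoning)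
open import Data.Empty using (⊥-elim)
open import Function.Bundles using (_⇔_; mk⇔; Equivalence)

if-yes : {A P : Set} (d : Dec P) {a b : A} → P → (if does d then a else b) ≡ a
if-yes d {a} {b} p = cong (λ c → if c then a else b) (dec-true d p)

if-no : {A P : Set} (d : Dec P) {a b : A} → ¬ P → (if does d then a else b) ≡ b
if-no d {a} {b} ¬p = cong (λ c → if c then a else b) (dec-false d ¬p)

%-absorbˡ : ∀ a b d .{{_ : NonZero d}} → (a % d + b) % d ≡ (a + b) % d
%-absorbˡ a b d = begin
    (a % d + b) % d           ≡⟨ %-distribˡ-+ (a % d) b d ⟩
    (a % d % d + b % d) % d   ≡⟨ cong (λ t → (t + b % d) % d) (m%n%n≡m%n a d) ⟩
    (a % d + b % d) % d       ≡⟨ %-distribˡ-+ a b d ⟨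
    (a + b) % d               ∎
  where open ≡-Reasoning

%-absorbʳ : ∀ a b d .{{_ : NonZero d}} → (a + b % d) % d ≡ (a + b) % d
%-absorbʳ a b d = begin
    (a + b % d) % d   ≡⟨ cong (_% d) (+-comm a (b % d)) ⟩
    (b % d + a) % d   ≡⟨ %-absorbˡ b a d ⟩
    (b + a) % d       ≡⟨ cong (_% d) (+-comm b a) ⟩
    (a + b) % d       ∎
  where open ≡-Reasoning

plus-bound : {q a : ℕ} → a ≤ q → a + 1 ≤ suc q
plus-bound {q} {a} a≤q = subst (_≤ suc q) (+-comm 1 a) (s≤s a≤q)

minus-bounds : {q a : ℕ} → 2 ≤ a → a ≤ suc q → 1 ≤ a ∸ 1 × a ∸ 1 ≤ q
minus-bounds {a = suc (suc b)} (s≤s (s≤s _)) (s≤s b+1≤q) = s≤s z≤n , b+1≤q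

-- Under the side conditions of (A3)-(A5) a value in [0, q+1] is bumped into [1, q+1].
bump-bounds : (q : ℕ) (s : Maybe Sign) (a : ℕ) → a ≤ suc q →
  (s ≡ just plus → a ≤ q) → (s ≡ just minus → 2 ≤ a) → (s ≡ nothing → 1 ≤ a) →
  1 ≤ bump s a × bump s a ≤ suc q
bump-bounds q (just plus) a _ plus-ok _ _ =
  subst (1 ≤_) (+-comm 1 a) (s≤s z≤n) , plus-bound (plus-ok refl)
bump-bounds q (just minus) a a≤q+1 _ minus-ok _ =
  let (lower , upper) = minus-bounds (minus-ok refl) a≤q+1 in lower , m≤n⇒m≤1+n upper
bump-bounds q nothing a a≤q+1 _ _ nothing-ok = nothing-ok refl , a≤q+1

bump-injective : (s : Maybe Sign) (a b : ℕ) → (s ≡ just minus → 1 ≤ a × 1 ≤ b) →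
  bump s a ≡ bump s b → a ≡ b
bump-injective (just plus) a b _ eq = +-cancelʳ-≡ 1 a b eq
bump-injective (just minus) a b positive eq =
  ∸-cancelʳ-≡ (proj₁ (positive refl)) (proj₂ (positive refl)) eq
bump-injective nothing a b _ eq = eq

bits-equal : {a b : ℕ} → a ≤ 1 → b ≤ 1 → (a ≡ 1 → b ≡ 1) → (b ≡ 1 → a ≡ 1) → a ≡ b
bits-equal {zero}      {zero}      _ _ _ _ = refl
bits-equal {zero}      {suc zero}  _ _ _ b⇒a = b⇒a refl
bits-equal {suc zero}  {zero}      _ _ a⇒b _ = sym (a⇒b refl)
bits-equal {suc zero}  {suc zero}  _ _ _ _ = refl
bits-equal {suc (suc _)} (s≤s ())
bits-equal {_} {suc (suc _)} _ (s≤s ())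

unbump : Maybe Sign → ℕ → ℕ
unbump (just plus)  b = b ∸ 1
unbump (just minus) b = b + 1
unbump nothing      b = b

bump-unbump : (s : Maybe Sign) (b : ℕ) → 1 ≤ b → bump s (unbump s b) ≡ b
bump-unbump (just plus)  (suc b) _ = +-comm b 1
bump-unbump (just minus) b       _ = m+n∸n≡m b 1
bump-unbump nothing      b       _ = refl

-- Under the side conditions of (B2)-(B4) a value in [1, q+2] is unbumped into [0, q+1].
unbump-bound : (q : ℕ) (s : Maybe Sign) (b : ℕ) → b ≤ 2 + q →
  (s ≡ just minus → b ≤ q) → (s ≡ nothing → b ≤ suc q) → unbump s b ≤ suc q
unbump-bound q (just plus)  b b≤q+2 _ _ = ∸-monoˡ-≤ 1 b≤q+2
unbump-bound q (just minus) b _ minus-ok _ = plus-bound (minus-ok refl)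
unbump-bound q nothing      b _ _ nothing-ok = nothing-ok refl

module _ {n : ℕ} where

  private
    f : ℕ
    f = suc n

  toℕ-⊕ : (x : Fin f) (k : ℕ) → toℕ (x ⊕ k) ≡ (toℕ x + k) % f
  toℕ-⊕ x k = toℕ-fromℕ< _

  ⊕-assoc : (x : Fin f) (a b : ℕ) → (x ⊕ a) ⊕ b ≡ x ⊕ (a + b)
  ⊕-assoc x a b = toℕ-injective (begin
      toℕ ((x ⊕ a) ⊕ b)          ≡⟨ toℕ-⊕ (x ⊕ a) b ⟩
      (toℕ (x ⊕ a) + b) % f      ≡⟨ cong (λ t → (t + b) % f) (toℕ-⊕ x a) ⟩
      ((toℕ x + a) % f + b) % f  ≡⟨ %-absorbˡ (toℕ x + a) b f ⟩
      (toℕ x + a + b) % f        ≡⟨ cong (_% f) (+-assoc (toℕ x) a b) ⟩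
      (toℕ x + (a + b)) % f      ≡⟨ toℕ-⊕ x (a + b) ⟨
      toℕ (x ⊕ (a + b))          ∎)
    where open ≡-Reasoning

  ⊕-f : (x : Fin f) → x ⊕ f ≡ x
  ⊕-f x = toℕ-injective (trans (toℕ-⊕ x f)
            (trans ([m+n]%n≡m%n (toℕ x) f) (m<n⇒m%n≡m (toℕ<n x))))

  pred-⊕1 : (x : Fin f) → pred x ⊕ 1 ≡ x
  pred-⊕1 x = trans (⊕-assoc x n 1) (trans (cong (x ⊕_) (+-comm n 1)) (⊕-f x))

  -- s + m - s ≡ m (mod f), written with the representative f ∸ toℕ s of -s;
  -- this is the computation behind both 'offset-⊕' and 'start-⊕-offset'.
  cancel-start : (s : Fin f) (m : ℕ) → (toℕ s + m + (f ∸ toℕ s)) % f ≡ m % f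
  cancel-start s m = begin
      (toℕ s + m + (f ∸ toℕ s)) % f     ≡⟨ cong (λ t → (t + (f ∸ toℕ s)) % f) (+-comm (toℕ s) m) ⟩
      (m + toℕ s + (f ∸ toℕ s)) % f     ≡⟨ cong (_% f) (+-assoc m (toℕ s) (f ∸ toℕ s)) ⟩
      (m + (toℕ s + (f ∸ toℕ s))) % f   ≡⟨ cong (λ t → (m + t) % f) (m+[n∸m]≡n (<⇒≤ (toℕ<n s))) ⟩
      (m + f) % f                       ≡⟨ [m+n]%n≡m%n m f ⟩
      m % f                             ∎
    where open ≡-Reasoning

  offset-⊕ : (I : Interval n) (m : ℕ) → offset I (start I ⊕ m) ≡ m % f
  offset-⊕ I m = begin
      (toℕ (s ⊕ m) + (f ∸ toℕ s)) % f       ≡⟨ cong (λ t → (t + (f ∸ toℕ s)) % f) (toℕ-⊕ s m) ⟩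
      ((toℕ s + m) % f + (f ∸ toℕ s)) % f   ≡⟨ %-absorbˡ (toℕ s + m) (f ∸ toℕ s) f ⟩
      (toℕ s + m + (f ∸ toℕ s)) % f         ≡⟨ cancel-start s m ⟩
      m % f                                 ∎
    where open ≡-Reasoning
          s = start I

  start-⊕-offset : (I : Interval n) (y : Fin f) → start I ⊕ offset I y ≡ y
  start-⊕-offset I y = toℕ-injective (begin
      toℕ (s ⊕ offset I y)                       ≡⟨ toℕ-⊕ s (offset I y) ⟩
      (toℕ s + (toℕ y + (f ∸ toℕ s)) % f) % f    ≡⟨ %-absorbʳ (toℕ s) (toℕ y + (f ∸ toℕ s)) f ⟩
      (toℕ s + (toℕ y + (f ∸ toℕ s))) % f        ≡⟨ cong (_% f) (+-assoc (toℕ s) (toℕ y) (f ∸ toℕ s)) ⟨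
      (toℕ s + toℕ y + (f ∸ toℕ s)) % f          ≡⟨ cancel-start s (toℕ y) ⟩
      toℕ y % f                                  ≡⟨ m<n⇒m%n≡m (toℕ<n y) ⟩
      toℕ y                                      ∎)
    where open ≡-Reasoning
          s = start I

  offset-start : (I : Interval n) → offset I (start I) ≡ 0
  offset-start I = trans (cong (_% f) (m+[n∸m]≡n (<⇒≤ (toℕ<n (start I))))) (n%n≡0 f)

  pred-succI∈ : (I : Interval n) → 1 ≤ len I → len I ≤ f → pred (succI I) ∈ᴵ I
  pred-succI∈ I@(mkI s (suc l) _) _ l<f = subst (_< suc l) (sym last) ≤-refl
    where
      open ≡-Reasoning
      last : offset I (pred (succI I)) ≡ l
      last = begin
        offset I (pred (s ⊕ suc l))   ≡⟨ cong (offset I) (⊕-assoc s (suc l) n) ⟩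
        offset I (s ⊕ (suc l + n))    ≡⟨ offset-⊕ I (suc l + n) ⟩
        (suc l + n) % f               ≡⟨ cong (_% f) (+-suc l n) ⟨
        (l + f) % f                   ≡⟨ [m+n]%n≡m%n l f ⟩
        l % f                         ≡⟨ m<n⇒m%n≡m l<f ⟩
        l                             ∎

  start-⊕-next : (I : Interval n) (x : Fin f) → start I ⊕ suc (offset I (pred x)) ≡ x
  start-⊕-next I x = begin
      start I ⊕ suc k        ≡⟨ cong (start I ⊕_) (+-comm 1 k) ⟩
      start I ⊕ (k + 1)      ≡⟨ ⊕-assoc (start I) k 1 ⟨
      (start I ⊕ k) ⊕ 1      ≡⟨ cong (_⊕ 1) (start-⊕-offset I (pred x)) ⟩
      pred x ⊕ 1             ≡⟨ pred-⊕1 x ⟩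
      x                      ∎
    where open ≡-Reasoning
          k = offset I (pred x)

  exit-point : (I : Interval n) → len I ≤ f → (x : Fin f) →
               pred x ∈ᴵ I → ¬ (x ∈ᴵ I) → succI I ≡ x
  exit-point I len≤f x k<len x∉I with suc (offset I (pred x)) <? len I
  ... | yes k+1<len = ⊥-elim (x∉I (subst (_< len I) (sym offset-x) k+1<len))
    where
      offset-x : offset I x ≡ suc (offset I (pred x))
      offset-x = trans (cong (offset I) (sym (start-⊕-next I x)))
                   (trans (offset-⊕ I _) (m<n⇒m%n≡m (<-≤-trans k+1<len len≤f)))
  ... | no k+1≮len =
    trans (cong (start I ⊕_) (≤-antisym (≮⇒≥ k+1≮len) k<len)) (start-⊕-next I x)

  disjoint-unique : {L : List (Interval n)} → AllPairs Disjoint L →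
    {I J : Interval n} → I ∈ L → J ∈ L → (y : Fin f) → y ∈ᴵ I → y ∈ᴵ J → I ≡ J
  disjoint-unique (_ ∷ _) (here refl) (here refl) y y∈I y∈J = refl
  disjoint-unique (I-disjoint ∷ _) (here refl) (there J∈L) y y∈I y∈J =
    ⊥-elim (All-lookup I-disjoint J∈L y (y∈I , y∈J))
  disjoint-unique (I-disjoint ∷ _) (there I∈L) (here refl) y y∈I y∈J =
    ⊥-elim (All-lookup I-disjoint I∈L y (y∈J , y∈I))
  disjoint-unique (_ ∷ rest-disjoint) (there I∈L) (there J∈L) y y∈I y∈J =
    disjoint-unique rest-disjoint I∈L J∈L y y∈I y∈J

  member-pred-succI∈ : {L : List (Interval n)} → WF L → {J : Interval n} → J ∈ L →
    pred (succI J) ∈ᴵ J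
  member-pred-succI∈ (lens , _) {J} J∈L =
    pred-succI∈ J (proj₁ (All-lookup lens J∈L)) (proj₂ (All-lookup lens J∈L))

  -- Distinct intervals of the collection have distinct successors,
  -- since they have distinct end points.
  succI-injective : {L : List (Interval n)} → WF L → {I J : Interval n} →
    I ∈ L → J ∈ L → succI I ≡ succI J → I ≡ J
  succI-injective wf@(_ , disjoint) {I} {J} I∈L J∈L eq =
    disjoint-unique disjoint I∈L J∈L (pred (succI I))
      (member-pred-succI∈ wf I∈L)
      (subst (λ y → pred y ∈ᴵ J) (sym eq) (member-pred-succI∈ wf J∈L))

  -- Start points of member intervals (which are nonempty) are covered.
  start-covered : {L : List (Interval n)} → WF L → (x : Fin f) → IsStart L x → InU L x
  start-covered (lens , _) x x-start with find x-start
  ... | J , J∈L , refl =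
    lose J∈L (subst (_< len J) (sym (offset-start J)) (proj₁ (All-lookup lens J∈L)))

  uncovered-not-start : {L : List (Interval n)} → WF L → (x : Fin f) →
    ¬ InU L x → ¬ IsStart L x
  uncovered-not-start wf x x∉U x-start = x∉U (start-covered wf x x-start)

  succSign-just : (L : List (Interval n)) (x : Fin f) {s : Sign} → succSign L x ≡ just s →
    ∃ λ J → J ∈ L × succI J ≡ x × sign J ≡ s
  succSign-just (I ∷ L) x eq with succI I ≟ᶠ x
  ... | yes succ≡x = I , here refl , succ≡x , just-injective eq
  ... | no _ with succSign-just L x eq
  ...   | J , J∈L , succ≡x , sign≡s = J , there J∈L , succ≡x , sign≡s

  succSign-nothing : (L : List (Interval n)) (x : Fin f) → succSign L x ≡ nothing →
    {J : Interval n} → J ∈ L → succI J ≢ x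
  succSign-nothing (I ∷ L) x eq J∈L succ≡x with succI I ≟ᶠ x
  succSign-nothing (I ∷ L) x () J∈L succ≡x | yes _
  succSign-nothing (I ∷ L) x eq (here refl) succ≡x | no succ≢x = succ≢x succ≡x
  succSign-nothing (I ∷ L) x eq (there J∈L) succ≡x | no _ = succSign-nothing L x eq J∈L succ≡x

  succSign-sole : (L : List (Interval n)) (x : Fin f) {J : Interval n} → J ∈ L →
    succI J ≡ x → (∀ {K} → K ∈ L → succI K ≡ x → K ≡ J) → succSign L x ≡ just (sign J)
  succSign-sole (I ∷ L) x J∈L succ≡x sole with succI I ≟ᶠ x
  ... | yes succI≡x = cong (λ K → just (sign K)) (sole (here refl) succI≡x)
  succSign-sole (I ∷ L) x (here refl) succ≡x sole | no succI≢x = ⊥-elim (succI≢x succ≡x)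
  succSign-sole (I ∷ L) x (there J∈L) succ≡x sole | no _ =
    succSign-sole L x J∈L succ≡x (λ K∈L → sole (there K∈L))

  -- By disjointness, 'succSign' at a member's successor finds that member's sign.
  succSign-succI : {L : List (Interval n)} → WF L → {I : Interval n} → I ∈ L →
    succSign L (succI I) ≡ just (sign I)
  succSign-succI {L} wf I∈L =
    succSign-sole L _ I∈L refl (λ K∈L eq → succI-injective wf K∈L I∈L eq)

  arrival-pred-covered : {L : List (Interval n)} → WF L → (x : Fin f) {s : Sign} →
    succSign L x ≡ just s → InU L (pred x)
  arrival-pred-covered {L} wf x arrives with succSign-just L x arrives
  ... | J , J∈L , refl , _ = lose J∈L (member-pred-succI∈ wf J∈L)

  decStart : (L : List (Interval n)) (x : Fin f) → Dec (IsStart L x)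
  decStart L x = any? (λ I → start I ≟ᶠ x) L

  decInU : (L : List (Interval n)) (x : Fin f) → Dec (InU L x)
  decInU L x = any? (λ I → offset I x <? len I) L

  data Position (L : List (Interval n)) (x : Fin f) : Set where
    atStart  : IsStart L x → Position L x
    interior : ¬ IsStart L x → InU L x → Position L x
    outside  : ¬ IsStart L x → ¬ InU L x → Position L x

  position : (L : List (Interval n)) (x : Fin f) → Position L x
  position L x with decStart L x | decInU L x
  ... | yes x-start | _        = atStart x-start
  ... | no ¬start   | yes x∈U  = interior ¬start x∈U
  ... | no ¬start   | no x∉U   = outside ¬start x∉U

  module _ (p : ℕ) (α : Fin f → ℕ) (L : List (Interval n)) (x : Fin f) where

    phi-start : IsStart L x → phi p α L x ≡ p
    phi-start x-start = if-yes (decStart L x) x-start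

    phi-interior : ¬ IsStart L x → InU L x → phi p α L x ≡ p ∸ 1
    phi-interior ¬start x∈U = trans (if-no (decStart L x) ¬start) (if-yes (decInU L x) x∈U)

    phi-outside : ¬ IsStart L x → ¬ InU L x → phi p α L x ≡ bump (succSign L x) (α x)
    phi-outside ¬start x∉U = trans (if-no (decStart L x) ¬start) (if-no (decInU L x) x∉U)

  phi-succI : (p : ℕ) (α : Fin f → ℕ) {L : List (Interval n)} → WF L →
    {I : Interval n} {s : Sign} → I ∈ L → sign I ≡ s → ¬ InU L (succI I) →
    phi p α L (succI I) ≡ bump (just s) (α (succI I))
  phi-succI p α {L} wf I∈L refl y∉U =
    trans (phi-outside p α L _ (uncovered-not-start wf _ y∉U) y∉U)
          (cong (λ s → bump s (α _)) (succSign-succI wf I∈L))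

  -- The candidate inverse of φ: on ⋃𝓘, α is forced by (A1)-(A2); outside
  -- ⋃𝓘 the value change of φ is undone.
  phiInv : (Fin f → ℕ) → List (Interval n) → Fin f → ℕ
  phiInv β L x =
    if does (decStart L x) then (if does (decInU L (pred x)) then 1 else 0)
    else if does (decInU L x) then 0
    else unbump (succSign L x) (β x)

  module _ (β : Fin f → ℕ) (L : List (Interval n)) (x : Fin f) where

    phiInv-start-covered : IsStart L x → InU L (pred x) → phiInv β L x ≡ 1
    phiInv-start-covered x-start pred∈U =
      trans (if-yes (decStart L x) x-start) (if-yes (decInU L (pred x)) pred∈U)

    phiInv-start-uncovered : IsStart L x → ¬ InU L (pred x) → phiInv β L x ≡ 0
    phiInv-start-uncovered x-start pred∉U =
      trans (if-yes (decStart L x) x-start) (if-no (decInU L (pred x)) pred∉U)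

    phiInv-interior : ¬ IsStart L x → InU L x → phiInv β L x ≡ 0
    phiInv-interior ¬start x∈U = trans (if-no (decStart L x) ¬start) (if-yes (decInU L x) x∈U)

    phiInv-outside : ¬ IsStart L x → ¬ InU L x → phiInv β L x ≡ unbump (succSign L x) (β x)
    phiInv-outside ¬start x∉U = trans (if-no (decStart L x) ¬start) (if-no (decInU L x) x∉U)

    phiInv-covered-bit : InU L x → phiInv β L x ≤ 1
    phiInv-covered-bit x∈U with position L x
    ... | atStart x-start = start-bit (decInU L (pred x))
      where
        start-bit : Dec (InU L (pred x)) → phiInv β L x ≤ 1
        start-bit (yes pred∈U) = ≤-reflexive (phiInv-start-covered x-start pred∈U)
        start-bit (no pred∉U) = subst (_≤ 1) (sym (phiInv-start-uncovered x-start pred∉U)) z≤n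
    ... | interior ¬start _ = subst (_≤ 1) (sym (phiInv-interior ¬start x∈U)) z≤n
    ... | outside _ x∉U = ⊥-elim (x∉U x∈U)

    phiInv-one⇔ : InU L x → (phiInv β L x ≡ 1 ⇔ (IsStart L x × InU L (pred x)))
    phiInv-one⇔ x∈U with position L x
    ... | atStart x-start = start-case (decInU L (pred x))
      where
        start-case : Dec (InU L (pred x)) → (phiInv β L x ≡ 1 ⇔ (IsStart L x × InU L (pred x)))
        start-case (yes pred∈U) =
          mk⇔ (λ _ → x-start , pred∈U) (λ _ → phiInv-start-covered x-start pred∈U)
        start-case (no pred∉U) =
          mk⇔ (λ one → ⊥-elim (0≢1+n (trans (sym (phiInv-start-uncovered x-start pred∉U)) one)))
              (λ (_ , pred∈U) → ⊥-elim (pred∉U pred∈U))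
    ... | interior ¬start _ =
      mk⇔ (λ one → ⊥-elim (0≢1+n (trans (sym (phiInv-interior ¬start x∈U)) one)))
          (λ (x-start , _) → ⊥-elim (¬start x-start))
    ... | outside _ x∉U = ⊥-elim (x∉U x∈U)

  -- (A3) for phiInv: where β is positive, an uncovered zero of phiInv is not
  -- the unchanged value β x, so it is reached by an interval, which covers
  -- its predecessor.
  phiInv-zero⇒pred-covered : (β : Fin f → ℕ) {L : List (Interval n)} → WF L →
    (x : Fin f) → 1 ≤ β x → ¬ InU L x → phiInv β L x ≡ 0 → InU L (pred x)
  phiInv-zero⇒pred-covered β {L} wf x 1≤βx x∉U vanishes = reached (succSign L x) refl
    where
      reached : (s : Maybe Sign) → succSign L x ≡ s → InU L (pred x)
      reached (just _) arrives = arrival-pred-covered wf x arrives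
      reached nothing arrives = ⊥-elim (1+n≰n (subst (1 ≤_) βx≡0 1≤βx))
        where
          open ≡-Reasoning
          βx≡0 : β x ≡ 0
          βx≡0 = begin
            β x                          ≡⟨ cong (λ s → unbump s (β x)) arrives ⟨
            unbump (succSign L x) (β x)  ≡⟨ phiInv-outside β L x (uncovered-not-start wf x x∉U) x∉U ⟨
            phiInv β L x                 ≡⟨ vanishes ⟩
            0                            ∎

  phiInv-succI : (β : Fin f → ℕ) {L : List (Interval n)} → WF L →
    {I : Interval n} {s : Sign} → I ∈ L → sign I ≡ s → ¬ InU L (succI I) →
    phiInv β L (succI I) ≡ unbump (just s) (β (succI I))
  phiInv-succI β {L} wf I∈L refl y∉U =
    trans (phiInv-outside β L _ (uncovered-not-start wf _ y∉U) y∉U)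
          (cong (λ s → unbump s (β _)) (succSign-succI wf I∈L))

-- From now on p = q + 2, which covers every prime p.
module _ {n q : ℕ} where

  private
    p : ℕ
    p = 2 + q

  -- Well-definedness of φ.
  module _ {α : Fin (suc n) → ℕ} {L : List (Interval n)} where

    arrival-plus : InLA p α L → (x : Fin (suc n)) → succSign L x ≡ just plus → α x ≤ q
    arrival-plus (_ , _ , _ , _ , _ , A4 , _) x arrives with succSign-just L x arrives
    ... | J , J∈L , refl , J-plus = proj₂ (A4 J J∈L J-plus)

    arrival-minus : InLA p α L → (x : Fin (suc n)) → ¬ InU L x →
      succSign L x ≡ just minus → 2 ≤ α x
    arrival-minus (_ , _ , _ , _ , _ , _ , A5) x x∉U arrives with succSign-just L x arrives
    ... | J , J∈L , refl , J-minus with A5 J J∈L J-minus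
    ...   | inj₁ (K , K∈L , _ , x∈K) = ⊥-elim (x∉U (lose K∈L x∈K))
    ...   | inj₂ (2≤αx , _) = 2≤αx

    -- (A3): an uncovered point that is no successor has α ≥ 1, since α = 0
    -- would put its predecessor in some J, making it the successor of J.
    unreached-positive : InLA p α L → (x : Fin (suc n)) → ¬ InU L x →
      succSign L x ≡ nothing → 1 ≤ α x
    unreached-positive ((lens , _) , _ , _ , _ , A3 , _) x x∉U unreached =
      n≢0⇒n>0 λ αx≡0 → let (J , J∈L , pred∈J) = find (A3 x x∉U αx≡0) in
        succSign-nothing L x unreached J∈L
          (exit-point J (proj₂ (All-lookup lens J∈L)) x pred∈J (λ x∈J → x∉U (lose J∈L x∈J)))

    phi-outside-bounds : InLA p α L → (x : Fin (suc n)) → ¬ InU L x →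
      1 ≤ phi p α L x × phi p α L x ≤ suc q
    phi-outside-bounds ia@(wf , bound , _) x x∉U
      rewrite phi-outside p α L x (uncovered-not-start wf x x∉U) x∉U =
      bump-bounds q (succSign L x) (α x) (bound x)
        (arrival-plus ia x) (arrival-minus ia x x∉U) (unreached-positive ia x x∉U)

    phi-top⇒start : InLA p α L → (x : Fin (suc n)) → phi p α L x ≡ p → IsStart L x
    phi-top⇒start ia x top with position L x
    ... | atStart x-start = x-start
    ... | interior ¬start x∈U =
      ⊥-elim (1+n≢n (trans (sym top) (phi-interior p α L x ¬start x∈U)))
    ... | outside _ x∉U =
      ⊥-elim (1+n≰n (subst (_≤ suc q) top (proj₂ (phi-outside-bounds ia x x∉U))))

    phi-wellDefined : InLA p α L → InLB p (phi p α L) L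
    phi-wellDefined ia@(wf , _ , A1 , _ , _ , A4 , A5) = wf , bounds , B1 , B2 , B3 , B4
      where
        β : Fin (suc n) → ℕ
        β = phi p α L

        bounds : ∀ x → 1 ≤ β x × β x ≤ p
        bounds x with position L x
        ... | atStart x-start rewrite phi-start p α L x x-start = s≤s z≤n , ≤-refl
        ... | interior ¬start x∈U rewrite phi-interior p α L x ¬start x∈U = s≤s z≤n , n≤1+n _
        ... | outside _ x∉U = let (lower , upper) = phi-outside-bounds ia x x∉U
                              in lower , m≤n⇒m≤1+n upper

        B1 : ∀ I → I ∈ L → ∀ x → x ∈ᴵ I → β x ≡ p ∸ 1 ⊎ β x ≡ p
        B1 I I∈L x x∈I with position L x
        ... | atStart x-start = inj₂ (phi-start p α L x x-start)
        ... | interior ¬start x∈U = inj₁ (phi-interior p α L x ¬start x∈U)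
        ... | outside _ x∉U = ⊥-elim (x∉U (lose I∈L x∈I))

        B2 : ∀ x → IsStart L x ⇔ β x ≡ p
        B2 x = mk⇔ (phi-start p α L x) (phi-top⇒start ia x)

        B3 : ∀ I → I ∈ L → sign I ≡ plus →
          ¬ InU L (succI I) × (1 ≤ β (succI I) × β (succI I) ≤ p ∸ 1)
        B3 I I∈L I-plus = let (y∉U , _) = A4 I I∈L I-plus in
          y∉U , phi-outside-bounds ia (succI I) y∉U

        B4 : ∀ I → I ∈ L → sign I ≡ minus →
          SuccInOther L I ⊎ (1 ≤ β (succI I) × β (succI I) ≤ p ∸ 2)
        B4 I I∈L I-minus with A5 I I∈L I-minus
        ... | inj₁ other = inj₁ other
        ... | inj₂ (2≤αy , αy≤q+1) =
          inj₂ (subst (λ b → 1 ≤ b × b ≤ q) (sym (phi-succI p α wf I∈L I-minus y∉U))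
                  (minus-bounds 2≤αy αy≤q+1))
          where
            -- covered points have α ≤ 1 by (A1)
            y∉U : ¬ InU L (succI I)
            y∉U y∈U = let (J , J∈L , y∈J) = find y∈U in
              1+n≰n (≤-trans 2≤αy (A1 J J∈L (succI I) y∈J))

  -- Injectivity of φ.
  module _ {α α′ : Fin (suc n) → ℕ} {L : List (Interval n)} where

    -- On ⋃𝓘 the value of α is forced by 𝓘: it lies in {0, 1} by (A1) and
    -- equals 1 exactly under the condition of (A2).
    covered-determined : InLA p α L → InLA p α′ L → (x : Fin (suc n)) → InU L x → α x ≡ α′ x
    covered-determined (_ , _ , A1 , A2 , _) (_ , _ , A1′ , A2′ , _) x x∈U with find x∈U
    ... | J , J∈L , x∈J =
      bits-equal (A1 J J∈L x x∈J) (A1′ J J∈L x x∈J)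
        (λ αx≡1 → Equivalence.from (A2′ x x∈U) (Equivalence.to (A2 x x∈U) αx≡1))
        (λ α′x≡1 → Equivalence.from (A2 x x∈U) (Equivalence.to (A2′ x x∈U) α′x≡1))

    -- Off ⋃𝓘, α is recovered from φ(α) because 'bump' is injective where it is
    -- applied: a negative bump only happens at values ≥ 2 (A5).
    phi-injective : InLA p α L → InLA p α′ L → phi p α L ≗ phi p α′ L → α ≗ α′
    phi-injective ia@(wf , _) ia′ same x with position L x
    ... | atStart x-start = covered-determined ia ia′ x (start-covered wf x x-start)
    ... | interior _ x∈U = covered-determined ia ia′ x x∈U
    ... | outside ¬start x∉U =
      bump-injective (succSign L x) (α x) (α′ x)
        (λ arrives → ≤-trans (s≤s z≤n) (arrival-minus ia x x∉U arrives)
                   , ≤-trans (s≤s z≤n) (arrival-minus ia′ x x∉U arrives))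
        (begin
          bump (succSign L x) (α x)    ≡⟨ phi-outside p α L x ¬start x∉U ⟨
          phi p α L x                  ≡⟨ same x ⟩
          phi p α′ L x                 ≡⟨ phi-outside p α′ L x ¬start x∉U ⟩
          bump (succSign L x) (α′ x)   ∎)
      where open ≡-Reasoning

  -- The inverse of φ.
  module _ {β : Fin (suc n) → ℕ} {L : List (Interval n)} where

    -- By (B2), only start points take the value p.
    nonStart-bound : InLB p β L → (x : Fin (suc n)) → ¬ IsStart L x → β x ≤ suc q
    nonStart-bound (_ , bounds , _ , B2 , _) x ¬start =
      ≤-pred (≤∧≢⇒< (proj₂ (bounds x)) (λ βx≡p → ¬start (Equivalence.from (B2 x) βx≡p)))

    arrivalB-minus : InLB p β L → (x : Fin (suc n)) → ¬ InU L x →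
      succSign L x ≡ just minus → β x ≤ q
    arrivalB-minus (_ , _ , _ , _ , _ , B4) x x∉U arrives with succSign-just L x arrives
    ... | J , J∈L , refl , J-minus with B4 J J∈L J-minus
    ...   | inj₁ (K , K∈L , _ , x∈K) = ⊥-elim (x∉U (lose K∈L x∈K))
    ...   | inj₂ (_ , βx≤q) = βx≤q

    phiInv-outside-bound : InLB p β L → (x : Fin (suc n)) → ¬ InU L x → phiInv β L x ≤ suc q
    phiInv-outside-bound ib@(wf , bounds , _) x x∉U =
      subst (_≤ suc q) (sym (phiInv-outside β L x ¬start x∉U))
        (unbump-bound q (succSign L x) (β x) (proj₂ (bounds x))
          (arrivalB-minus ib x x∉U) (λ _ → nonStart-bound ib x ¬start))
      where
        ¬start : ¬ IsStart L x
        ¬start = uncovered-not-start wf x x∉U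

    phiInv-wellDefined : InLB p β L → InLA p (phiInv β L) L
    phiInv-wellDefined ib@(wf , bounds , B1 , _ , B3 , B4) = wf , α-bounds , A1 , A2 , A3 , A4 , A5
      where
        α : Fin (suc n) → ℕ
        α = phiInv β L

        α-bounds : ∀ x → α x ≤ p ∸ 1
        α-bounds x with position L x
        ... | atStart x-start = ≤-trans (phiInv-covered-bit β L x (start-covered wf x x-start)) (s≤s z≤n)
        ... | interior _ x∈U = ≤-trans (phiInv-covered-bit β L x x∈U) (s≤s z≤n)
        ... | outside _ x∉U = phiInv-outside-bound ib x x∉U

        A1 : ∀ I → I ∈ L → ∀ x → x ∈ᴵ I → α x ≤ 1
        A1 I I∈L x x∈I = phiInv-covered-bit β L x (lose I∈L x∈I)

        A2 : ∀ x → InU L x → (α x ≡ 1 ⇔ (IsStart L x × InU L (pred x)))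
        A2 x = phiInv-one⇔ β L x

        A3 : ∀ x → ¬ InU L x → α x ≡ 0 → InU L (pred x)
        A3 x = phiInv-zero⇒pred-covered β wf x (proj₁ (bounds x))

        A4 : ∀ I → I ∈ L → sign I ≡ plus → ¬ InU L (succI I) × α (succI I) ≤ p ∸ 2
        A4 I I∈L I-plus = let (y∉U , _ , βy≤q+1) = B3 I I∈L I-plus in
          y∉U , subst (_≤ q) (sym (phiInv-succI β wf I∈L I-plus y∉U)) (∸-monoˡ-≤ 1 βy≤q+1)

        A5 : ∀ I → I ∈ L → sign I ≡ minus →
          SuccInOther L I ⊎ (2 ≤ α (succI I) × α (succI I) ≤ p ∸ 1)
        A5 I I∈L I-minus with B4 I I∈L I-minus
        ... | inj₁ other = inj₁ other
        ... | inj₂ (1≤βy , βy≤q) =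
          inj₂ (subst (λ a → 2 ≤ a × a ≤ suc q) (sym (phiInv-succI β wf I∈L I-minus y∉U))
                  (+-monoˡ-≤ 1 1≤βy , plus-bound βy≤q))
          where
            -- covered points have β ≥ p - 1 by (B1)
            y∉U : ¬ InU L (succI I)
            y∉U y∈U with find y∈U
            ... | J , J∈L , y∈J with B1 J J∈L (succI I) y∈J
            ...   | inj₁ βy≡q+1 = 1+n≰n (subst (_≤ q) βy≡q+1 βy≤q)
            ...   | inj₂ βy≡q+2 = 1+n≰n (≤-trans (subst (_≤ q) βy≡q+2 βy≤q) (n≤1+n q))

    -- At interior points β = p - 1: (B1) leaves p - 1 or p, and p is excluded by (B2).
    interior-value : InLB p β L → (x : Fin (suc n)) → ¬ IsStart L x → InU L x → β x ≡ suc q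
    interior-value (_ , _ , B1 , B2 , _) x ¬start x∈U with find x∈U
    ... | J , J∈L , x∈J with B1 J J∈L x x∈J
    ...   | inj₁ βx≡q+1 = βx≡q+1
    ...   | inj₂ βx≡p = ⊥-elim (¬start (Equivalence.from (B2 x) βx≡p))

    phi-phiInv : InLB p β L → phi p (phiInv β L) L ≗ β
    phi-phiInv ib@(_ , bounds , _ , B2 , _) x with position L x
    ... | atStart x-start =
      trans (phi-start p (phiInv β L) L x x-start) (sym (Equivalence.to (B2 x) x-start))
    ... | interior ¬start x∈U =
      trans (phi-interior p (phiInv β L) L x ¬start x∈U) (sym (interior-value ib x ¬start x∈U))
    ... | outside ¬start x∉U = begin
      phi p (phiInv β L) L x               ≡⟨ phi-outside p (phiInv β L) L x ¬start x∉U ⟩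
      bump s (phiInv β L x)                ≡⟨ cong (bump s) (phiInv-outside β L x ¬start x∉U) ⟩
      bump s (unbump s (β x))              ≡⟨ bump-unbump s (β x) (proj₁ (bounds x)) ⟩
      β x                                  ∎
      where open ≡-Reasoning
            s : Maybe Sign
            s = succSign L x

lemma11p5 : (n p : ℕ) → Prime p →
    ((α : Fin (suc n) → ℕ) (L : List (Interval n)) → InLA p α L → InLB p (phi p α L) L)
    × ((α α′ : Fin (suc n) → ℕ) (L : List (Interval n)) → InLA p α L → InLA p α′ L →
         phi p α L ≗ phi p α′ L → α ≗ α′)
    × ((β : Fin (suc n) → ℕ) (L : List (Interval n)) → InLB p β L →
         ∃ λ α → InLA p α L × phi p α L ≗ β)
lemma11p5 n zero          p-prime = ⊥-elim (NonTrivial.nonTrivial (prime⇒nonTrivial p-prime))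
lemma11p5 n (suc zero)    p-prime = ⊥-elim (NonTrivial.nonTrivial (prime⇒nonTrivial p-prime))
lemma11p5 n (suc (suc q)) _ =
    (λ α L → phi-wellDefined)
  , (λ α α′ L → phi-injective)
  , (λ β L β∈B → phiInv β L , phiInv-wellDefined β∈B , phi-phiInv β∈B)
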